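{- Let $k\geq 3$ and let $p$ be the partially ordered pattern of length $k$ on the labels $\{1,\dots,k\}$ whose only relation is $1>k$ (all other pairs of labels are incomparable). Then for every $n\geq 0$ there is a bijection between the set of $n$-permutations avoiding $p$ and the set of permutations $\sigma$ of $\{1,\dots,n\}$ such that for each cycle $c$ of $\sigma$, the smallest integer interval containing all elements of $c$ has at most $k-1$ elements (i.e. $\max c-\min c\leq k-2$).
   Context: An $n$-permutation is a permutation $\pi=\pi_1\cdots\pi_n$ of $\{1,\dots,n\}$ written in one-line notation (for $n=0$ there is exactly one, the empty permutation). A partially ordered pattern (POP) $p$ of length $k$ is a partial order $<_P$ on the label set $\{1,\dots,k\}$. An occurrence of $p$ in $\pi$ is a subsequence $\pi_{i_1}\pi_{i_2}\cdots\pi_{i_k}$ with $1\leq i_1<\cdots<i_k\leq n$ such that $\pi_{i_j}<\pi_{i_m}$ whenever $j<_P m$ (no condition is imposed on pairs of incomparable labels). A permutation avoids $p$ if it contains no occurrence of $p$. -}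

module Defs where

open import Level using (0ℓ)
open import Data.Nat using (ℕ; zero; suc; _+_; _∸_; _≤_; s≤s)
open import Data.Fin using (Fin; toℕ; _<_)
open import Data.Product using (Σ; ∃; _×_; _,_; proj₁)
open import Relation.Nullary using (¬_)
open import Relation.Binary.PropositionalEquality using (_≡_; refl; sym; trans)
open import Relation.Binary.Bundles using (Setoid)
open import Function.Definitions using (Injective)

-- An n-permutation in one-line notation: π i is the value at position i
-- (positions and values 0-indexed via Fin n); it is a bijection
-- Fin n → Fin n, i.e. (for finite sets) an injective map.
IsPerm : {n : ℕ} → (Fin n → Fin n) → Set
IsPerm {n} π = Injective _≡_ _≡_ π

record POP (k : ℕ) : Set₁ where
  field
    _<P_   : Fin k → Fin k → Set
    irrefl : ∀ a → ¬ (a <P a)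
    trans< : ∀ {a b c} → a <P b → b <P c → a <P c

Occurrence : {k n : ℕ} → POP k → (Fin n → Fin n) → Set
Occurrence {k} {n} p π =
  Σ (Fin k → Fin n) λ ι →
    (∀ a b → a < b → ι a < ι b) ×
    (∀ j m → POP._<P_ p j m → π (ι j) < π (ι m))

Avoids : {k n : ℕ} → POP k → (Fin n → Fin n) → Set
Avoids p π = ¬ Occurrence p π

-- The POP of length k whose only relation is  k <P 1  (i.e. 1 > k).
-- Labels 1..k correspond to Fin k elements with toℕ 0..k-1.
lastFirst< : (k : ℕ) → Fin k → Fin k → Set
lastFirst< k j m = (toℕ j ≡ k ∸ 1) × (toℕ m ≡ 0)

lastFirst-irrefl : (k : ℕ) → 2 ≤ k → ∀ a → ¬ lastFirst< k a a
lastFirst-irrefl (suc (suc k')) (s≤s (s≤s _)) a (e1 , e0) with trans (sym e1) e0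
... | ()

lastFirst-trans : (k : ℕ) → 2 ≤ k → ∀ {a b c} →
  lastFirst< k a b → lastFirst< k b c → lastFirst< k a c
lastFirst-trans (suc (suc k')) (s≤s (s≤s _)) (e1 , e0) (f1 , f0) with trans (sym f1) e0
... | ()

lastFirstPOP : (k : ℕ) → 2 ≤ k → POP k
lastFirstPOP k 2≤k = record
  { _<P_ = lastFirst< k
  ; irrefl = lastFirst-irrefl k 2≤k
  ; trans< = lastFirst-trans k 2≤k
  }

iter : {n : ℕ} → (Fin n → Fin n) → ℕ → Fin n → Fin n
iter σ zero x = x
iter σ (suc j) x = σ (iter σ j x)

-- The cycle of x is
-- {σ^i x | i ∈ ℕ}; max c - min c ≤ d is equivalent to all pairwise
-- differences within c being ≤ d.
CyclesSpanAtMost : {n : ℕ} → ℕ → (Fin n → Fin n) → Set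
CyclesSpanAtMost d σ =
  ∀ x i j → toℕ (iter σ i x) ≤ toℕ (iter σ j x) + d

PermSetoid : (n : ℕ) → ((Fin n → Fin n) → Set) → Setoid 0ℓ 0ℓ
PermSetoid n P = record
  { Carrier = Σ (Fin n → Fin n) (λ π → IsPerm π × P π)
  ; _≈_ = λ a b → ∀ i → proj₁ a i ≡ proj₁ b i
  ; isEquivalence = record
    { refl = λ i → refl
    ; sym = λ e i → sym (e i)
    ; trans = λ e f i → trans (e i) (f i)
    }
  }

AvoidersSetoid : {k : ℕ} → POP k → (n : ℕ) → Setoid 0ℓ 0ℓ
AvoidersSetoid p n = PermSetoid n (Avoids p)

SmallCycleSetoid : ℕ → (n : ℕ) → Setoid 0ℓ 0ℓ
SmallCycleSetoid d n = PermSetoid n (CyclesSpanAtMost d)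

-- A permutation π avoids the pattern exactly when π x < π y whenever y − x > k − 2: an
-- occurrence is a pair of positions at least k − 1 apart whose values are inverted.
-- The bijection reads π from its first entry: the cycles of the standardised tail of π,
-- shifted up by one, receive the new point 0 either as a fixed point (if π 0 is the least
-- value) or right after the position that carries the value π 0 − 1.  By induction, the
-- cycle of x stays below t exactly when π x is smaller than every value of π beyond
-- position t; taking t = x + (k − 2) turns avoidance into the bound max c − min c ≤ k − 2.

module Submission where

open import Defs
open import Data.Nat using (ℕ; zero; suc; _+_; _∸_; _≤_; _<_; z≤n; s≤s; s≤s⁻¹; _≤?_; _<?_)
open import Data.Nat.Properties
  using ( ≤-trans; n≤1+n; ≤-reflexive; <⇒≤; <-≤-trans; ≤-<-trans; <-irrefl; <-asym; <⇒≢; <⇒≱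
        ; ≰⇒>; ≮⇒≥; ≤∧≢⇒<; n<1+n; 1+n≰n; m≤m+n; m≤n⇒∃[o]m+o≡n; +-suc; +-identityʳ
        ; +-monoˡ-≤; +-monoʳ-≤; +-monoʳ-<; module ≤-Reasoning )
open import Data.Fin using (Fin; zero; suc; toℕ; punchIn; punchOut; fromℕ; fromℕ<)
open import Data.Fin.Properties
  using ( _≟_; any?; pigeonhole; injective⇒≤; 0≢1+n; suc-injective; toℕ-injective; toℕ<n
        ; toℕ-fromℕ; toℕ-fromℕ<; punchIn-punchOut; punchIn-injective; punchInᵢ≢i
        ; punchIn-mono-≤; punchIn-cancel-≤; punchOut-injective )
open import Data.Maybe using (Maybe; just; nothing)
open import Data.Product using (Σ; ∃; ∃₂; _×_; _,_; proj₁; proj₂)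
open import Data.Sum using (_⊎_; inj₁; inj₂)
open import Data.Empty using (⊥-elim)
open import Level using (0ℓ)
open import Function using (_∘_; id)
open import Function.Bundles using (Bijection; _⇔_; mk⇔; Equivalence)
open import Function.Definitions using (Injective; Surjective)
open import Function.Construct.Composition using (_⇔-∘_)
open import Function.Construct.Symmetry using (⇔-sym)
open import Relation.Nullary using (¬_; Dec; yes; no; contradiction)
open import Relation.Binary.Bundles using (Setoid)
open import Relation.Binary.PropositionalEquality
  using (_≡_; _≢_; _≗_; refl; sym; trans; cong; cong₂; subst; subst₂; module ≡-Reasoning)

open Equivalence using (to; from)

private
  variable
    n t : ℕ

module _ (f : Fin n → Fin n) where

  iter-+ : ∀ a b x → iter f (a + b) x ≡ iter f a (iter f b x)
  iter-+ zero    b x = refl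
  iter-+ (suc a) b x = cong f (iter-+ a b x)

  iter-sucʳ : ∀ k x → iter f (suc k) x ≡ iter f k (f x)
  iter-sucʳ zero    x = refl
  iter-sucʳ (suc k) x = cong f (iter-sucʳ k x)

  iter-injective : IsPerm f → ∀ k → Injective _≡_ _≡_ (iter f k)
  iter-injective f-inj zero    eq = eq
  iter-injective f-inj (suc k) eq = iter-injective f-inj k (f-inj eq)

  iter-periodic : IsPerm f → ∀ x → ∃ λ p → iter f (suc p) x ≡ x
  iter-periodic f-inj x
    with i , j , i<j , fⁱx≡fʲx ← pigeonhole (n<1+n n) (λ (i : Fin (suc n)) → iter f (toℕ i) x)
    with r , 1+i+r≡j ← m≤n⇒∃[o]m+o≡n i<j
    = r , sym (iter-injective f-inj (toℕ i) (begin
      iter f (toℕ i) x                   ≡⟨ fⁱx≡fʲx ⟩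
      iter f (toℕ j) x                   ≡⟨ cong (λ k → iter f k x) j≡i+1+r ⟩
      iter f (toℕ i + suc r) x           ≡⟨ iter-+ (toℕ i) (suc r) x ⟩
      iter f (toℕ i) (iter f (suc r) x)  ∎))
    where
    open ≡-Reasoning
    j≡i+1+r : toℕ j ≡ toℕ i + suc r
    j≡i+1+r = trans (sym 1+i+r≡j) (sym (+-suc (toℕ i) r))

  iter-returns : IsPerm f → ∀ x j → ∃ λ k → iter f k (iter f j x) ≡ x
  iter-returns f-inj x zero    = 0 , refl
  iter-returns f-inj x (suc j)
    with p , fᵖ⁺¹y≡y ← iter-periodic f-inj (iter f j x)
    with k , fᵏy≡x ← iter-returns f-inj x j
    = k + p , (begin
      iter f (k + p) (f y)          ≡⟨ iter-+ k p (f y) ⟩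
      iter f k (iter f p (f y))     ≡⟨ cong (iter f k) (sym (iter-sucʳ p y)) ⟩
      iter f k (iter f (suc p) y)   ≡⟨ cong (iter f k) fᵖ⁺¹y≡y ⟩
      iter f k y                    ≡⟨ fᵏy≡x ⟩
      x                             ∎)
    where
    open ≡-Reasoning
    y = iter f j x

iter-cong : {f g : Fin n → Fin n} → f ≗ g → ∀ k → iter f k ≗ iter g k
iter-cong         f≗g zero    x = refl
iter-cong {f = f} f≗g (suc k) x = trans (cong f (iter-cong f≗g k x)) (f≗g _)

injective⇒surjective : {f : Fin n → Fin n} → IsPerm f → ∀ y → ∃ λ x → f x ≡ y
injective⇒surjective {suc n} {f} f-inj y with any? (λ x → f x ≟ y)
... | yes hit  = hit
... | no  miss = contradiction (injective⇒≤ punchOut∘f-injective) 1+n≰n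
  where
  f≢y : ∀ x → y ≢ f x
  f≢y x y≡fx = miss (x , sym y≡fx)
  punchOut∘f-injective : Injective _≡_ _≡_ (λ x → punchOut (f≢y x))
  punchOut∘f-injective eq = f-inj (punchOut-injective (f≢y _) (f≢y _) eq)

OrbitBounded : (Fin n → Fin n) → Fin n → ℕ → Set
OrbitBounded f x t = ∀ k → toℕ (iter f k x) ≤ t

module _ {f : Fin n → Fin n} where

  orbitBounded⇒≤ : ∀ {x} → OrbitBounded f x t → toℕ x ≤ t
  orbitBounded⇒≤ bounded = bounded 0

  orbitBounded-next : ∀ {x} → OrbitBounded f x t → OrbitBounded f (f x) t
  orbitBounded-next {x = x} bounded k =
    subst (λ y → toℕ y ≤ _) (iter-sucʳ f k x) (bounded (suc k))

  orbitBounded-cons : ∀ {x} → toℕ x ≤ t → OrbitBounded f (f x) t → OrbitBounded f x t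
  orbitBounded-cons         x≤t bounded zero    = x≤t
  orbitBounded-cons {x = x} x≤t bounded (suc k) =
    subst (λ y → toℕ y ≤ _) (sym (iter-sucʳ f k x)) (bounded k)

  orbitBounded-prev : IsPerm f → ∀ {x} → OrbitBounded f (f x) t → OrbitBounded f x t
  orbitBounded-prev f-inj {x} bounded with p , fᵖ⁺¹x≡x ← iter-periodic f f-inj x =
    orbitBounded-cons (subst (λ y → toℕ y ≤ _) (trans (sym (iter-sucʳ f p x)) fᵖ⁺¹x≡x) (bounded p))
                      bounded

cyclesSpanAtMost⇔orbitsBounded : ∀ {d} {σ : Fin n → Fin n} → IsPerm σ →
  CyclesSpanAtMost d σ ⇔ (∀ x → OrbitBounded σ x (toℕ x + d))
cyclesSpanAtMost⇔orbitsBounded {d = d} {σ} σ-inj = mk⇔ (λ span x k → span x k 0) bounded⇒span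
  where
  bounded⇒span : (∀ x → OrbitBounded σ x (toℕ x + d)) → CyclesSpanAtMost d σ
  bounded⇒span bounded x i j with k , σᵏy≡x ← iter-returns σ σ-inj x j =
    subst (λ z → toℕ z ≤ toℕ y + d) σⁱ⁺ᵏy≡σⁱx (bounded y (i + k))
    where
    y = iter σ j x
    σⁱ⁺ᵏy≡σⁱx : iter σ (i + k) y ≡ iter σ i x
    σⁱ⁺ᵏy≡σⁱx = trans (iter-+ σ i k y) (cong (iter σ i) σᵏy≡x)

cyclesSpanAtMost-resp-≗ : ∀ {d} {σ τ : Fin n → Fin n} →
  σ ≗ τ → CyclesSpanAtMost d σ → CyclesSpanAtMost d τ
cyclesSpanAtMost-resp-≗ σ≗τ span x i j =
  subst₂ (λ a b → toℕ a ≤ toℕ b + _) (iter-cong σ≗τ i x) (iter-cong σ≗τ j x) (span x i j)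

BelowLaterValues : (Fin n → Fin n) → Fin n → ℕ → Set
BelowLaterValues π x t = ∀ i → t < toℕ i → toℕ (π x) < toℕ (π i)

belowLaterValues⇒≤ : ∀ {π : Fin n → Fin n} {x} → BelowLaterValues π x t → toℕ x ≤ t
belowLaterValues⇒≤ {x = x} below = ≮⇒≥ (λ t<x → <-irrefl refl (below x t<x))

IncreasingBeyond : ℕ → (Fin n → Fin n) → Set
IncreasingBeyond d π = ∀ x → BelowLaterValues π x (toℕ x + d)

strictlyIncreasing-spread : ∀ {k} (ι : Fin (suc k) → Fin n) →
  (∀ a b → toℕ a < toℕ b → toℕ (ι a) < toℕ (ι b)) → ∀ a → toℕ (ι zero) + toℕ a ≤ toℕ (ι a)
strictlyIncreasing-spread ι increasing zero = ≤-reflexive (+-identityʳ _)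
strictlyIncreasing-spread {k = suc k} ι increasing (suc a) = begin
  toℕ (ι zero) + suc (toℕ a)   ≡⟨ +-suc (toℕ (ι zero)) (toℕ a) ⟩
  suc (toℕ (ι zero) + toℕ a)   ≤⟨ +-monoˡ-≤ (toℕ a) (increasing zero (suc zero) (s≤s z≤n)) ⟩
  toℕ (ι (suc zero)) + toℕ a   ≤⟨ strictlyIncreasing-spread (ι ∘ suc) increasing∘suc a ⟩
  toℕ (ι (suc a))              ∎
  where
  open ≤-Reasoning
  increasing∘suc : ∀ a b → toℕ a < toℕ b → toℕ (ι (suc a)) < toℕ (ι (suc b))
  increasing∘suc a b a<b = increasing (suc a) (suc b) (s≤s a<b)

-- Positions x, x + 1, …, x + d, y: an occurrence of the pattern whenever π y < π x.
module SpreadPositions {d} {x y : Fin n} (x+d<y : toℕ x + d < toℕ y) where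

  positions : Fin (suc (suc d)) → Fin n
  positions a with toℕ a ≤? d
  ... | yes a≤d = fromℕ< (≤-<-trans (+-monoʳ-≤ (toℕ x) a≤d) (<-≤-trans x+d<y (<⇒≤ (toℕ<n y))))
  ... | no  _   = y

  positions-≤ : ∀ a → toℕ a ≤ d → toℕ (positions a) ≡ toℕ x + toℕ a
  positions-≤ a a≤d with toℕ a ≤? d
  ... | yes _   = toℕ-fromℕ< _
  ... | no  a≰d = contradiction a≤d a≰d

  positions-> : ∀ a → ¬ toℕ a ≤ d → positions a ≡ y
  positions-> a a≰d with toℕ a ≤? d
  ... | yes a≤d = contradiction a≤d a≰d
  ... | no  _   = refl

  positions-zero : positions zero ≡ x
  positions-zero = toℕ-injective (trans (positions-≤ zero z≤n) (+-identityʳ (toℕ x)))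

  positions-increasing : ∀ a b → toℕ a < toℕ b → toℕ (positions a) < toℕ (positions b)
  positions-increasing a b a<b = compare (toℕ b ≤? d)
    where
    a≤d : toℕ a ≤ d
    a≤d = s≤s⁻¹ (<-≤-trans a<b (s≤s⁻¹ (toℕ<n b)))
    compare : Dec (toℕ b ≤ d) → toℕ (positions a) < toℕ (positions b)
    compare (yes b≤d) = subst₂ _<_ (sym (positions-≤ a a≤d)) (sym (positions-≤ b b≤d))
                          (+-monoʳ-< (toℕ x) a<b)
    compare (no  b≰d) = subst₂ _<_ (sym (positions-≤ a a≤d)) (cong toℕ (sym (positions-> b b≰d)))
                          (≤-<-trans (+-monoʳ-≤ (toℕ x) a≤d) x+d<y)

avoids⇔increasingBeyond : ∀ {d} (2≤k : 2 ≤ suc (suc d)) {π : Fin n → Fin n} → IsPerm π →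
  Avoids (lastFirstPOP (suc (suc d)) 2≤k) π ⇔ IncreasingBeyond d π
avoids⇔increasingBeyond {n = n} {d} 2≤k {π} π-inj = mk⇔ avoids⇒increasing increasing⇒avoids
  where
  last : Fin (suc (suc d))
  last = fromℕ (suc d)

  avoids⇒increasing : Avoids (lastFirstPOP (suc (suc d)) 2≤k) π → IncreasingBeyond d π
  avoids⇒increasing avoids x y x+d<y with toℕ (π x) <? toℕ (π y)
  ... | yes πx<πy = πx<πy
  ... | no  πx≮πy = contradiction (positions , positions-increasing , inverted) avoids
    where
    open SpreadPositions {d = d} {x} {y} x+d<y
    πy≢πx : toℕ (π y) ≢ toℕ (π x)
    πy≢πx πy≡πx =
      <⇒≢ (≤-<-trans (m≤m+n (toℕ x) d) x+d<y) (cong toℕ (π-inj (toℕ-injective (sym πy≡πx))))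
    inverted : ∀ j m → lastFirst< (suc (suc d)) j m → toℕ (π (positions j)) < toℕ (π (positions m))
    inverted j m (j≡1+d , m≡0) =
      subst₂ (λ a b → toℕ (π a) < toℕ (π b))
        (sym (positions-> j (λ j≤d → 1+n≰n (subst (_≤ d) j≡1+d j≤d))))
        (sym (trans (cong positions (toℕ-injective {j = zero} m≡0)) positions-zero))
        (≤∧≢⇒< (≮⇒≥ πx≮πy) πy≢πx)

  increasing⇒avoids : IncreasingBeyond d π → Avoids (lastFirstPOP (suc (suc d)) 2≤k) π
  increasing⇒avoids increasing (ι , ι-increasing , inverted) =
    <-asym (inverted last zero (toℕ-fromℕ (suc d) , refl)) (increasing (ι zero) (ι last) ι₀+d<ιₗ)
    where
    ι₀+d<ιₗ : toℕ (ι zero) + d < toℕ (ι last)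
    ι₀+d<ιₗ = subst (_≤ toℕ (ι last))
                (trans (cong (toℕ (ι zero) +_) (toℕ-fromℕ (suc d))) (+-suc (toℕ (ι zero)) d))
                (strictlyIncreasing-spread ι ι-increasing last)

punchIn-<⇔ : ∀ (i : Fin (suc n)) j k → toℕ (punchIn i j) < toℕ (punchIn i k) ⇔ toℕ j < toℕ k
punchIn-<⇔ i j k = mk⇔
  (λ j′<k′ → ≰⇒> (λ k≤j → <⇒≱ j′<k′ (punchIn-mono-≤ i k j k≤j)))
  (λ j<k → ≰⇒> (λ k′≤j′ → <⇒≱ j<k (punchIn-cancel-≤ i k j k′≤j′)))

<-punchIn⇔≤ : ∀ (i : Fin (suc n)) w → toℕ i < toℕ (punchIn i w) ⇔ toℕ i ≤ toℕ w
<-punchIn⇔≤ zero    w       = mk⇔ (λ _ → z≤n) (λ _ → s≤s z≤n)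
<-punchIn⇔≤ (suc i) zero    = mk⇔ (λ ()) (λ ())
<-punchIn⇔≤ (suc i) (suc w) =
  mk⇔ (s≤s ∘ to (<-punchIn⇔≤ i w) ∘ s≤s⁻¹) (s≤s ∘ from (<-punchIn⇔≤ i w) ∘ s≤s⁻¹)

dropZero : (g : Fin n → Fin (suc n)) → (∀ y → g y ≢ zero) → Fin n → Fin n
dropZero g g≢0 y = punchOut (g≢0 y ∘ sym)

suc-dropZero : ∀ (g : Fin n → Fin (suc n)) g≢0 y → suc (dropZero g g≢0 y) ≡ g y
suc-dropZero g g≢0 y = punchIn-punchOut (g≢0 y ∘ sym)

dropZero-injective : ∀ {g : Fin n → Fin (suc n)} g≢0 → Injective _≡_ _≡_ g → IsPerm (dropZero g g≢0)
dropZero-injective g≢0 g-inj eq = g-inj (punchOut-injective (g≢0 _ ∘ sym) (g≢0 _ ∘ sym) eq)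

standardTail : (π : Fin (suc n) → Fin (suc n)) → IsPerm π → Fin n → Fin n
standardTail π π-inj ℓ = punchOut (head≢tail ℓ)
  where
  head≢tail : ∀ ℓ → π zero ≢ π (suc ℓ)
  head≢tail ℓ π0≡πℓ = 0≢1+n (π-inj π0≡πℓ)

module _ {π : Fin (suc n) → Fin (suc n)} (π-inj : IsPerm π) where

  standardTail-punchIn : ∀ ℓ → π (suc ℓ) ≡ punchIn (π zero) (standardTail π π-inj ℓ)
  standardTail-punchIn ℓ = sym (punchIn-punchOut _)

  standardTail-injective : IsPerm (standardTail π π-inj)
  standardTail-injective {ℓ} {ℓ′} eq = suc-injective (π-inj (begin
    π (suc ℓ)                                     ≡⟨ standardTail-punchIn ℓ ⟩
    punchIn (π zero) (standardTail π π-inj ℓ)     ≡⟨ cong (punchIn (π zero)) eq ⟩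
    punchIn (π zero) (standardTail π π-inj ℓ′)    ≡⟨ standardTail-punchIn ℓ′ ⟨
    π (suc ℓ′)                                    ∎))
    where open ≡-Reasoning

  standardTail-unique : ∀ {g} → (∀ ℓ → π (suc ℓ) ≡ punchIn (π zero) (g ℓ)) →
    standardTail π π-inj ≗ g
  standardTail-unique π≡punchIn∘g ℓ =
    punchIn-injective (π zero) _ _ (trans (sym (standardTail-punchIn ℓ)) (π≡punchIn∘g ℓ))

standardTail-cong : ∀ {π₁ π₂ : Fin (suc n) → Fin (suc n)} (π₁-inj : IsPerm π₁) (π₂-inj : IsPerm π₂) →
  π₁ ≗ π₂ → standardTail π₁ π₁-inj ≗ standardTail π₂ π₂-inj
standardTail-cong π₁-inj π₂-inj π₁≗π₂ = standardTail-unique π₁-inj λ ℓ →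
  trans (π₁≗π₂ (suc ℓ))
        (trans (standardTail-punchIn π₂-inj ℓ) (cong (λ v → punchIn v _) (sym (π₁≗π₂ zero))))

prepend : Fin (suc n) → (Fin n → Fin n) → Fin (suc n) → Fin (suc n)
prepend v g zero    = v
prepend v g (suc ℓ) = punchIn v (g ℓ)

prepend-injective : ∀ v {g : Fin n → Fin n} → IsPerm g → IsPerm (prepend v g)
prepend-injective v g-inj {zero}  {zero}   eq = refl
prepend-injective v g-inj {zero}  {suc ℓ}  eq = contradiction (sym eq) (punchInᵢ≢i v _)
prepend-injective v g-inj {suc ℓ} {zero}   eq = contradiction eq (punchInᵢ≢i v _)
prepend-injective v g-inj {suc ℓ} {suc ℓ′} eq = cong suc (g-inj (punchIn-injective v _ _ eq))

-- Extends σ by a new point 0, shifting the old points up by one: as a fixed point (nothing),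
-- or placed on the cycle of σ right after a (just a).
insertZero : (Fin n → Fin n) → Maybe (Fin n) → Fin (suc n) → Fin (suc n)
insertZero σ nothing  zero    = zero
insertZero σ nothing  (suc y) = suc (σ y)
insertZero σ (just a) zero    = suc (σ a)
insertZero σ (just a) (suc y) with y ≟ a
... | yes _ = zero
... | no  _ = suc (σ y)

module _ (σ : Fin n → Fin n) where

  insertZero-after : ∀ a → insertZero σ (just a) (suc a) ≡ zero
  insertZero-after a with a ≟ a
  ... | yes _   = refl
  ... | no  a≢a = contradiction refl a≢a

  insertZero-other : ∀ {a y} → y ≢ a → insertZero σ (just a) (suc y) ≡ suc (σ y)
  insertZero-other {a} {y} y≢a with y ≟ a
  ... | yes y≡a = contradiction y≡a y≢a
  ... | no  _   = refl

  insertZero-suc : ∀ c y →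
    (c ≡ just y × insertZero σ c (suc y) ≡ zero) ⊎ insertZero σ c (suc y) ≡ suc (σ y)
  insertZero-suc nothing  y = inj₂ refl
  insertZero-suc (just a) y with y ≟ a
  ... | yes refl = inj₁ (refl , refl)
  ... | no  _    = inj₂ refl

  insertZero-injective : IsPerm σ → ∀ c → IsPerm (insertZero σ c)
  insertZero-injective σ-inj nothing  {zero}  {zero}  eq = refl
  insertZero-injective σ-inj nothing  {suc x} {suc y} eq = cong suc (σ-inj (suc-injective eq))
  insertZero-injective σ-inj (just a) {zero}  {zero}  eq = refl
  insertZero-injective σ-inj (just a) {zero}  {suc y} eq with y ≟ a
  ... | no y≢a = contradiction (sym (σ-inj (suc-injective eq))) y≢a
  insertZero-injective σ-inj (just a) {suc x} {zero}  eq with x ≟ a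
  ... | no x≢a = contradiction (σ-inj (suc-injective eq)) x≢a
  insertZero-injective σ-inj (just a) {suc x} {suc y} eq with x ≟ a | y ≟ a
  ... | yes x≡a | yes y≡a = cong suc (trans x≡a (sym y≡a))
  ... | no  _   | no  _   = cong suc (σ-inj (suc-injective eq))

insertZero-cong : ∀ {σ₁ σ₂ : Fin n → Fin n} c → σ₁ ≗ σ₂ → insertZero σ₁ c ≗ insertZero σ₂ c
insertZero-cong nothing  σ₁≗σ₂ zero    = refl
insertZero-cong nothing  σ₁≗σ₂ (suc y) = cong suc (σ₁≗σ₂ y)
insertZero-cong (just a) σ₁≗σ₂ zero    = cong suc (σ₁≗σ₂ a)
insertZero-cong (just a) σ₁≗σ₂ (suc y) with y ≟ a
... | yes _ = refl
... | no  _ = cong suc (σ₁≗σ₂ y)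

insertZero-cancel : ∀ {σ₁ σ₂ : Fin n → Fin n} c₁ c₂ →
  insertZero σ₁ c₁ ≗ insertZero σ₂ c₂ → c₁ ≡ c₂ × σ₁ ≗ σ₂
insertZero-cancel nothing  nothing  eq = refl , λ y → suc-injective (eq (suc y))
insertZero-cancel nothing  (just _) eq with () ← eq zero
insertZero-cancel (just _) nothing  eq with () ← eq zero
insertZero-cancel {σ₁ = σ₁} {σ₂} (just a) (just b) eq with insertZero-suc σ₂ (just b) a
... | inj₂ σ̂₂[1+a]≡ =
  contradiction (trans (sym (insertZero-after σ₁ a)) (trans (eq (suc a)) σ̂₂[1+a]≡)) 0≢1+n
... | inj₁ (refl , _) = refl , σ₁≗σ₂
  where
  σ₁≗σ₂ : σ₁ ≗ σ₂
  σ₁≗σ₂ y with insertZero-suc σ₁ (just a) y | insertZero-suc σ₂ (just a) y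
  ... | inj₁ (refl , _) | _               = suc-injective (eq zero)
  ... | inj₂ _          | inj₁ (refl , _) = suc-injective (eq zero)
  ... | inj₂ σ̂₁[1+y]≡   | inj₂ σ̂₂[1+y]≡   =
    suc-injective (trans (sym σ̂₁[1+y]≡) (trans (eq (suc y)) σ̂₂[1+y]≡))

insertZero-surjective : {σ : Fin (suc n) → Fin (suc n)} → IsPerm σ →
  ∃₂ λ σ′ c → IsPerm σ′ × σ ≗ insertZero σ′ c
insertZero-surjective {σ = σ} σ-inj with injective⇒surjective σ-inj zero
... | zero , σ0≡0 = σ′ , nothing , dropZero-injective σ∘suc≢0 (suc-injective ∘ σ-inj) , σ≗σ̂
  where
  σ∘suc≢0 : ∀ y → σ (suc y) ≢ zero
  σ∘suc≢0 y σ[1+y]≡0 = 0≢1+n (σ-inj (trans σ0≡0 (sym σ[1+y]≡0)))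
  σ′ = dropZero (σ ∘ suc) σ∘suc≢0
  σ≗σ̂ : σ ≗ insertZero σ′ nothing
  σ≗σ̂ zero    = σ0≡0
  σ≗σ̂ (suc y) = sym (suc-dropZero (σ ∘ suc) σ∘suc≢0 y)
... | suc a , σ[1+a]≡0 = σ′ , just a , dropZero-injective σ∘bypass≢0 (bypass-injective ∘ σ-inj) , σ≗σ̂
  where
  -- `insertZero id (just a)` transposes 0 and suc a, so σ ∘ bypass skips over 0 on its cycle.
  bypass : Fin _ → Fin (suc _)
  bypass y = insertZero id (just a) (suc y)
  bypass-injective : Injective _≡_ _≡_ bypass
  bypass-injective = suc-injective ∘ insertZero-injective id id (just a)
  σ∘bypass≢0 : ∀ y → σ (bypass y) ≢ zero
  σ∘bypass≢0 y σ[bypass-y]≡0 with y ≟ a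
  ... | yes refl = 0≢1+n (σ-inj (trans σ[bypass-y]≡0 (sym σ[1+a]≡0)))
  ... | no  y≢a  = y≢a (suc-injective (σ-inj (trans σ[bypass-y]≡0 (sym σ[1+a]≡0))))
  σ′ = dropZero (σ ∘ bypass) σ∘bypass≢0
  σ≗σ̂ : σ ≗ insertZero σ′ (just a)
  σ≗σ̂ zero = trans (cong σ (sym (insertZero-after id a))) (sym (suc-dropZero (σ ∘ bypass) σ∘bypass≢0 a))
  σ≗σ̂ (suc y) with y ≟ a
  ... | yes refl = σ[1+a]≡0
  ... | no  y≢a  =
    trans (cong σ (sym (insertZero-other id y≢a))) (sym (suc-dropZero (σ ∘ bypass) σ∘bypass≢0 y))

module _ {σ : Fin n → Fin n} where

  insertZero-step : ∀ c y → ∃ λ j → iter (insertZero σ c) (suc j) (suc y) ≡ suc (σ y)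
  insertZero-step c y with insertZero-suc σ c y
  ... | inj₂ σ̂[1+y]≡1+σy      = 0 , σ̂[1+y]≡1+σy
  ... | inj₁ (refl , σ̂[1+y]≡0) = 1 , cong (insertZero σ c) σ̂[1+y]≡0

  insertZero-iter-suc : ∀ c y k → ∃ λ k′ → iter (insertZero σ c) k′ (suc y) ≡ suc (iter σ k y)
  insertZero-iter-suc c y zero    = 0 , refl
  insertZero-iter-suc c y (suc k)
    with k′ , σ̂ᵏ′≡ ← insertZero-iter-suc c y k
    with j , σ̂ʲ⁺¹≡ ← insertZero-step c (iter σ k y)
    = suc j + k′
    , trans (iter-+ σ̂ (suc j) k′ (suc y)) (trans (cong (iter σ̂ (suc j)) σ̂ᵏ′≡) σ̂ʲ⁺¹≡)
    where σ̂ = insertZero σ c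

  insertZero-iter-suc⁻¹ : ∀ c y k → ∃ λ k′ →
    iter (insertZero σ c) k (suc y) ≡ suc (iter σ k′ y) ⊎
    (iter (insertZero σ c) k (suc y) ≡ zero × c ≡ just (iter σ k′ y))
  insertZero-iter-suc⁻¹ c y zero = 0 , inj₁ refl
  insertZero-iter-suc⁻¹ c y (suc k) with insertZero-iter-suc⁻¹ c y k
  ... | k′ , inj₂ (σ̂ᵏ≡0 , refl) = suc k′ , inj₁ (cong (insertZero σ c) σ̂ᵏ≡0)
  ... | k′ , inj₁ σ̂ᵏ≡ with insertZero-suc σ c (iter σ k′ y)
  ...   | inj₁ (c≡ , σ̂≡0) = k′ , inj₂ (trans (cong (insertZero σ c) σ̂ᵏ≡) σ̂≡0 , c≡)
  ...   | inj₂ σ̂≡         = suc k′ , inj₁ (trans (cong (insertZero σ c) σ̂ᵏ≡) σ̂≡)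

  orbitBounded-insertZero-suc⁺ : ∀ c {y} →
    OrbitBounded σ y t → OrbitBounded (insertZero σ c) (suc y) (suc t)
  orbitBounded-insertZero-suc⁺ c {y} bounded k with insertZero-iter-suc⁻¹ c y k
  ... | k′ , inj₁ σ̂ᵏ≡        = subst (λ w → toℕ w ≤ _) (sym σ̂ᵏ≡) (s≤s (bounded k′))
  ... | k′ , inj₂ (σ̂ᵏ≡0 , _) = subst (λ w → toℕ w ≤ _) (sym σ̂ᵏ≡0) z≤n

  orbitBounded-insertZero-suc⁻ : ∀ c {y} →
    OrbitBounded (insertZero σ c) (suc y) (suc t) → OrbitBounded σ y t
  orbitBounded-insertZero-suc⁻ c {y} bounded k with k′ , σ̂ᵏ′≡ ← insertZero-iter-suc c y k =
    s≤s⁻¹ (subst (λ w → toℕ w ≤ _) σ̂ᵏ′≡ (bounded k′))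

  orbitBounded-insertZero-nothing : OrbitBounded (insertZero σ nothing) zero t
  orbitBounded-insertZero-nothing k = subst (λ w → toℕ w ≤ _) (sym (fixed k)) z≤n
    where
    fixed : ∀ k → iter (insertZero σ nothing) k zero ≡ zero
    fixed zero    = refl
    fixed (suc k) = cong (insertZero σ nothing) (fixed k)

  orbitBounded-insertZero-just : IsPerm σ → ∀ a →
    OrbitBounded (insertZero σ (just a)) zero (suc t) ⇔ OrbitBounded σ a t
  orbitBounded-insertZero-just σ-inj a = mk⇔
    (orbitBounded-prev σ-inj ∘ orbitBounded-insertZero-suc⁻ (just a) ∘ orbitBounded-next)
    (orbitBounded-cons z≤n ∘ orbitBounded-insertZero-suc⁺ (just a) ∘ orbitBounded-next)

insertionPoint : Fin (suc n) → (τ : Fin n → Fin n) → IsPerm τ → Maybe (Fin n)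
insertionPoint zero    τ τ-inj = nothing
insertionPoint (suc v) τ τ-inj = just (proj₁ (injective⇒surjective τ-inj v))

insertionValue : Maybe (Fin n) → (Fin n → Fin n) → Fin (suc n)
insertionValue nothing  τ = zero
insertionValue (just a) τ = suc (τ a)

insertionValue-cong : ∀ c {τ₁ τ₂ : Fin n → Fin n} →
  τ₁ ≗ τ₂ → insertionValue c τ₁ ≡ insertionValue c τ₂
insertionValue-cong nothing  τ₁≗τ₂ = refl
insertionValue-cong (just a) τ₁≗τ₂ = cong suc (τ₁≗τ₂ a)

module _ {τ : Fin n → Fin n} (τ-inj : IsPerm τ) where

  insertionValue-insertionPoint : ∀ v → insertionValue (insertionPoint v τ τ-inj) τ ≡ v
  insertionValue-insertionPoint zero    = refl
  insertionValue-insertionPoint (suc v) = cong suc (proj₂ (injective⇒surjective τ-inj v))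

  insertionPoint-insertionValue : ∀ c → insertionPoint (insertionValue c τ) τ τ-inj ≡ c
  insertionPoint-insertionValue nothing  = refl
  insertionPoint-insertionValue (just a) =
    cong just (τ-inj (proj₂ (injective⇒surjective τ-inj (τ a))))

insertionPoint-cong : ∀ v {τ₁ τ₂ : Fin n → Fin n} (τ₁-inj : IsPerm τ₁) (τ₂-inj : IsPerm τ₂) →
  τ₁ ≗ τ₂ → insertionPoint v τ₁ τ₁-inj ≡ insertionPoint v τ₂ τ₂-inj
insertionPoint-cong zero    τ₁-inj τ₂-inj τ₁≗τ₂ = refl
insertionPoint-cong (suc v) τ₁-inj τ₂-inj τ₁≗τ₂ = cong just (τ₁-inj (trans
  (proj₂ (injective⇒surjective τ₁-inj v))
  (sym (trans (τ₁≗τ₂ _) (proj₂ (injective⇒surjective τ₂-inj v))))))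

toCycles : (π : Fin n → Fin n) → IsPerm π → Fin n → Fin n
toCycles {n = zero}  π π-inj = π
toCycles {n = suc n} π π-inj = insertZero (toCycles τ τ-inj) (insertionPoint (π zero) τ τ-inj)
  where
  τ = standardTail π π-inj
  τ-inj = standardTail-injective π-inj

toCycles-injective : ∀ (π : Fin n → Fin n) (π-inj : IsPerm π) → IsPerm (toCycles π π-inj)
toCycles-injective {n = zero}  π π-inj eq = π-inj eq
toCycles-injective {n = suc n} π π-inj =
  insertZero-injective (toCycles τ τ-inj) (toCycles-injective τ τ-inj) (insertionPoint (π zero) τ τ-inj)
  where
  τ = standardTail π π-inj
  τ-inj = standardTail-injective π-inj

toCycles-cong : ∀ {π₁ π₂ : Fin n → Fin n} (π₁-inj : IsPerm π₁) (π₂-inj : IsPerm π₂) →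
  π₁ ≗ π₂ → toCycles π₁ π₁-inj ≗ toCycles π₂ π₂-inj
toCycles-cong {n = zero}  π₁-inj π₂-inj π₁≗π₂ = π₁≗π₂
toCycles-cong {n = suc n} {π₁} {π₂} π₁-inj π₂-inj π₁≗π₂ x = begin
  insertZero (toCycles τ₁ τ₁-inj) c₁ x
    ≡⟨ insertZero-cong c₁ (toCycles-cong τ₁-inj τ₂-inj τ₁≗τ₂) x ⟩
  insertZero (toCycles τ₂ τ₂-inj) c₁ x
    ≡⟨ cong (λ c → insertZero (toCycles τ₂ τ₂-inj) c x) c₁≡c₂ ⟩
  insertZero (toCycles τ₂ τ₂-inj) c₂ x ∎
  where
  open ≡-Reasoning
  τ₁ = standardTail π₁ π₁-inj
  τ₂ = standardTail π₂ π₂-inj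
  τ₁-inj = standardTail-injective π₁-inj
  τ₂-inj = standardTail-injective π₂-inj
  τ₁≗τ₂ = standardTail-cong π₁-inj π₂-inj π₁≗π₂
  c₁ = insertionPoint (π₁ zero) τ₁ τ₁-inj
  c₂ = insertionPoint (π₂ zero) τ₂ τ₂-inj
  c₁≡c₂ : c₁ ≡ c₂
  c₁≡c₂ = trans (cong (λ v → insertionPoint v τ₁ τ₁-inj) (π₁≗π₂ zero))
                (insertionPoint-cong (π₂ zero) τ₁-inj τ₂-inj τ₁≗τ₂)

toCycles-cancel : ∀ {π₁ π₂ : Fin n → Fin n} (π₁-inj : IsPerm π₁) (π₂-inj : IsPerm π₂) →
  toCycles π₁ π₁-inj ≗ toCycles π₂ π₂-inj → π₁ ≗ π₂
toCycles-cancel {n = zero}  π₁-inj π₂-inj eq = eq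
toCycles-cancel {n = suc n} {π₁} {π₂} π₁-inj π₂-inj eq = π₁≗π₂
  where
  τ₁ = standardTail π₁ π₁-inj
  τ₂ = standardTail π₂ π₂-inj
  τ₁-inj = standardTail-injective π₁-inj
  τ₂-inj = standardTail-injective π₂-inj
  c₁ = insertionPoint (π₁ zero) τ₁ τ₁-inj
  c₂ = insertionPoint (π₂ zero) τ₂ τ₂-inj
  c₁≡c₂,σ₁≗σ₂ = insertZero-cancel c₁ c₂ eq
  τ₁≗τ₂ : τ₁ ≗ τ₂
  τ₁≗τ₂ = toCycles-cancel τ₁-inj τ₂-inj (proj₂ c₁≡c₂,σ₁≗σ₂)
  π₁0≡π₂0 : π₁ zero ≡ π₂ zero
  π₁0≡π₂0 = begin
    π₁ zero                ≡⟨ insertionValue-insertionPoint τ₁-inj (π₁ zero) ⟨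
    insertionValue c₁ τ₁   ≡⟨ cong (λ c → insertionValue c τ₁) (proj₁ c₁≡c₂,σ₁≗σ₂) ⟩
    insertionValue c₂ τ₁   ≡⟨ insertionValue-cong c₂ τ₁≗τ₂ ⟩
    insertionValue c₂ τ₂   ≡⟨ insertionValue-insertionPoint τ₂-inj (π₂ zero) ⟩
    π₂ zero                ∎
    where open ≡-Reasoning
  π₁≗π₂ : π₁ ≗ π₂
  π₁≗π₂ zero    = π₁0≡π₂0
  π₁≗π₂ (suc ℓ) = begin
    π₁ (suc ℓ)               ≡⟨ standardTail-punchIn π₁-inj ℓ ⟩
    punchIn (π₁ zero) (τ₁ ℓ) ≡⟨ cong₂ punchIn π₁0≡π₂0 (τ₁≗τ₂ ℓ) ⟩
    punchIn (π₂ zero) (τ₂ ℓ) ≡⟨ standardTail-punchIn π₂-inj ℓ ⟨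
    π₂ (suc ℓ)               ∎
    where open ≡-Reasoning

toCycles-surjective : ∀ {σ : Fin n → Fin n} → IsPerm σ →
  ∃ λ π → Σ (IsPerm π) λ π-inj → toCycles π π-inj ≗ σ
toCycles-surjective {n = zero}  {σ} σ-inj = σ , σ-inj , λ ()
toCycles-surjective {n = suc n} {σ} σ-inj
  with σ′ , c , σ′-inj , σ≗σ̂ ← insertZero-surjective σ-inj
  with π′ , π′-inj , toCycles-π′≗σ′ ← toCycles-surjective σ′-inj
  = π , π-inj , toCycles-π≗σ
  where
  π = prepend (insertionValue c π′) π′
  π-inj = prepend-injective (insertionValue c π′) π′-inj
  τ = standardTail π π-inj
  τ-inj = standardTail-injective π-inj
  τ≗π′ : τ ≗ π′
  τ≗π′ = standardTail-unique π-inj (λ ℓ → refl)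
  toCycles-π≗σ : toCycles π π-inj ≗ σ
  toCycles-π≗σ x = begin
    insertZero (toCycles τ τ-inj) (insertionPoint (π zero) τ τ-inj) x
      ≡⟨ cong (λ c → insertZero (toCycles τ τ-inj) c x)
              (insertionPoint-cong (π zero) τ-inj π′-inj τ≗π′) ⟩
    insertZero (toCycles τ τ-inj) (insertionPoint (π zero) π′ π′-inj) x
      ≡⟨ cong (λ c → insertZero (toCycles τ τ-inj) c x) (insertionPoint-insertionValue π′-inj c) ⟩
    insertZero (toCycles τ τ-inj) c x
      ≡⟨ insertZero-cong c (λ y → trans (toCycles-cong τ-inj π′-inj τ≗π′ y) (toCycles-π′≗σ′ y)) x ⟩
    insertZero σ′ c x
      ≡⟨ σ≗σ̂ x ⟨
    σ x ∎
    where open ≡-Reasoning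

Tracks : (Fin n → Fin n) → (Fin n → Fin n) → Set
Tracks σ π = ∀ x t → OrbitBounded σ x t ⇔ BelowLaterValues π x t

module _ {π : Fin (suc n) → Fin (suc n)} (π-inj : IsPerm π) where

  private
    τ = standardTail π π-inj

  tail<tail⇔ : ∀ y i → toℕ (π (suc y)) < toℕ (π (suc i)) ⇔ toℕ (τ y) < toℕ (τ i)
  tail<tail⇔ y i = subst₂ (λ u w → (toℕ u < toℕ w) ⇔ (toℕ (τ y) < toℕ (τ i)))
    (sym (standardTail-punchIn π-inj y)) (sym (standardTail-punchIn π-inj i))
    (punchIn-<⇔ (π zero) (τ y) (τ i))

  head<tail⇔ : ∀ {v a} → π zero ≡ suc v → τ a ≡ v →
    ∀ i → toℕ (π zero) < toℕ (π (suc i)) ⇔ toℕ (τ a) < toℕ (τ i)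
  head<tail⇔ {v} {a} π0≡1+v τa≡v i = subst₂ (λ u w → (toℕ u < toℕ w) ⇔ (toℕ (τ a) < toℕ (τ i)))
    (sym π0≡1+v) (sym (trans (standardTail-punchIn π-inj i) (cong (λ u → punchIn u (τ i)) π0≡1+v)))
    (subst (λ u → toℕ (suc v) < toℕ (punchIn (suc v) (τ i)) ⇔ (toℕ u < toℕ (τ i)))
           (sym τa≡v) (<-punchIn⇔≤ (suc v) (τ i)))

  belowLaterValues-tail : ∀ y → BelowLaterValues π (suc y) (suc t) ⇔ BelowLaterValues τ y t
  belowLaterValues-tail y = mk⇔
    (λ below i t<i → to (tail<tail⇔ y i) (below (suc i) (s≤s t<i)))
    (λ { below (suc i) (s≤s t<i) → from (tail<tail⇔ y i) (below i t<i) })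

  belowLaterValues-head : ∀ {v a} → π zero ≡ suc v → τ a ≡ v →
    BelowLaterValues π zero (suc t) ⇔ BelowLaterValues τ a t
  belowLaterValues-head π0≡1+v τa≡v = mk⇔
    (λ below i t<i → to (head<tail⇔ π0≡1+v τa≡v i) (below (suc i) (s≤s t<i)))
    (λ { below (suc i) (s≤s t<i) → from (head<tail⇔ π0≡1+v τa≡v i) (below i t<i) })

  belowLaterValues-least : π zero ≡ zero → BelowLaterValues π zero t
  belowLaterValues-least π0≡0 (suc i) _ = subst₂ (λ u w → toℕ u < toℕ w)
    (sym π0≡0) (sym (trans (standardTail-punchIn π-inj i) (cong (λ u → punchIn u (τ i)) π0≡0)))
    (s≤s z≤n)

tracks-insertZero-zero : ∀ {π : Fin (suc n) → Fin (suc n)} (π-inj : IsPerm π) {σ} → IsPerm σ →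
  Tracks σ (standardTail π π-inj) → ∀ v → π zero ≡ v → ∀ t →
  OrbitBounded (insertZero σ (insertionPoint v (standardTail π π-inj) (standardTail-injective π-inj))) zero t
    ⇔ BelowLaterValues π zero t
tracks-insertZero-zero π-inj σ-inj tracks zero π0≡0 t =
  mk⇔ (λ _ → belowLaterValues-least π-inj π0≡0) (λ _ → orbitBounded-insertZero-nothing)
tracks-insertZero-zero {π = π} π-inj {σ} σ-inj tracks (suc v) π0≡1+v t
  with a , τa≡v ← injective⇒surjective (standardTail-injective π-inj) v = tracks-after t
  where
  tracks-after : ∀ t → OrbitBounded (insertZero σ (just a)) zero t ⇔ BelowLaterValues π zero t
  tracks-after zero = mk⇔
    (λ bounded → contradiction (bounded 1) (λ ()))
    (λ below → ⊥-elim (<-irrefl refl (to (head<tail⇔ π-inj π0≡1+v τa≡v a) (below (suc a) (s≤s z≤n)))))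
  tracks-after (suc t) =
    ⇔-sym (belowLaterValues-head π-inj π0≡1+v τa≡v) ⇔-∘
    (tracks a t ⇔-∘ orbitBounded-insertZero-just σ-inj a)

tracks-insertZero : ∀ {π : Fin (suc n) → Fin (suc n)} (π-inj : IsPerm π) {σ} → IsPerm σ →
  Tracks σ (standardTail π π-inj) →
  Tracks (insertZero σ (insertionPoint (π zero) (standardTail π π-inj) (standardTail-injective π-inj))) π
tracks-insertZero π-inj σ-inj tracks zero t = tracks-insertZero-zero π-inj σ-inj tracks _ refl t
tracks-insertZero π-inj σ-inj tracks (suc y) zero = mk⇔
  (λ bounded → contradiction (orbitBounded⇒≤ bounded) (λ ()))
  (λ below → contradiction (belowLaterValues⇒≤ below) (λ ()))
tracks-insertZero {π = π} π-inj σ-inj tracks (suc y) (suc t) =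
  ⇔-sym (belowLaterValues-tail π-inj y) ⇔-∘
  (tracks y t ⇔-∘ mk⇔ (orbitBounded-insertZero-suc⁻ c) (orbitBounded-insertZero-suc⁺ c))
  where c = insertionPoint (π zero) (standardTail π π-inj) (standardTail-injective π-inj)

toCycles-tracks : ∀ (π : Fin n → Fin n) (π-inj : IsPerm π) → Tracks (toCycles π π-inj) π
toCycles-tracks {n = zero}  π π-inj ()
toCycles-tracks {n = suc n} π π-inj =
  tracks-insertZero π-inj (toCycles-injective τ τ-inj) (toCycles-tracks τ τ-inj)
  where
  τ = standardTail π π-inj
  τ-inj = standardTail-injective π-inj

toCycles-cyclesSpanAtMost⇔ : ∀ d (π : Fin n → Fin n) (π-inj : IsPerm π) →
  CyclesSpanAtMost d (toCycles π π-inj) ⇔ IncreasingBeyond d π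
toCycles-cyclesSpanAtMost⇔ d π π-inj =
  mk⇔ (λ bounded x → to (tracks x _) (bounded x)) (λ increasing x → from (tracks x _) (increasing x))
  ⇔-∘ cyclesSpanAtMost⇔orbitsBounded (toCycles-injective π π-inj)
  where tracks = toCycles-tracks π π-inj

avoids⇔toCycles-cyclesSpanAtMost : ∀ {d} (2≤k : 2 ≤ suc (suc d)) (π : Fin n → Fin n) (π-inj : IsPerm π) →
  Avoids (lastFirstPOP (suc (suc d)) 2≤k) π ⇔ CyclesSpanAtMost d (toCycles π π-inj)
avoids⇔toCycles-cyclesSpanAtMost {d = d} 2≤k π π-inj =
  ⇔-sym (toCycles-cyclesSpanAtMost⇔ d π π-inj) ⇔-∘ avoids⇔increasingBeyond 2≤k π-inj

theorem7 : (k : ℕ) → (3≤k : 3 ≤ k) → (n : ℕ) →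
    Bijection (AvoidersSetoid (lastFirstPOP k (≤-trans (n≤1+n 2) 3≤k)) n)
    (SmallCycleSetoid (k ∸ 2) n)
theorem7 zero          ()       n
theorem7 (suc zero)    (s≤s ()) n
theorem7 (suc (suc d)) 3≤k      n = record
  { to        = toCycles′
  ; cong      = λ {(_ , π₁-inj , _)} {(_ , π₂-inj , _)} → toCycles-cong π₁-inj π₂-inj
  ; bijective = (λ {(_ , π₁-inj , _)} {(_ , π₂-inj , _)} → toCycles-cancel π₁-inj π₂-inj) , surjective
  }
  where
  2≤k : 2 ≤ suc (suc d)
  2≤k = ≤-trans (n≤1+n 2) 3≤k
  Avoiders SmallCycles : Setoid 0ℓ 0ℓ
  Avoiders    = AvoidersSetoid (lastFirstPOP (suc (suc d)) 2≤k) n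
  SmallCycles = SmallCycleSetoid d n

  toCycles′ : Setoid.Carrier Avoiders → Setoid.Carrier SmallCycles
  toCycles′ (π , π-inj , avoids) =
    toCycles π π-inj , toCycles-injective π π-inj , to (avoids⇔toCycles-cyclesSpanAtMost 2≤k π π-inj) avoids

  surjective : Surjective (Setoid._≈_ Avoiders) (Setoid._≈_ SmallCycles) toCycles′
  surjective (σ , σ-inj , small) with π , π-inj , toCycles-π≗σ ← toCycles-surjective σ-inj =
    (π , π-inj , from (avoids⇔toCycles-cyclesSpanAtMost 2≤k π π-inj)
                      (cyclesSpanAtMost-resp-≗ (sym ∘ toCycles-π≗σ) small)) ,
    λ {(_ , π′-inj , _)} π′≗π x → trans (toCycles-cong π′-inj π-inj π′≗π x) (toCycles-π≗σ x)
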